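{- Let $S$ be an update sequence of length $m$ on $[n]$, let $P\supseteq P(S)$ be a point set all of whose points are valid, and let $E=\langle T_0,\tau_1\to\tau'_1,\dots,\tau_m\to\tau'_m\rangle$ be an execution of $S$, with $T_t$ the tree after the $t$-th reconfiguration. Then for every update point $p\in U(S)$ we have $\mathrm{pred}(p)=\mathrm{pred}_{T_{p_t}}(p_x)$ and $\mathrm{succ}(p)=\mathrm{succ}_{T_{p_t}}(p_x)$ (identifying a point $(x',p_t)$ with the element $x'$; in particular one side exists iff the other does).
   Context: Update sequences. $S=\langle (s_1,\mathrm{op}_1),\dots,(s_m,\mathrm{op}_m)\rangle$ with $s_t\in[n]$, $\mathrm{op}_t\in\{\mathtt{access},\mathtt{insert},\mathtt{delete}\}$; standing assumptions: for each element its insertions and deletions alternate along $S$, and every $x\in[n]$ occurs in $S$. BST model. A BST is a binary search tree on distinct keys from $[n]$; for a BST $T$ and key $y$, $\mathrm{pred}_T(y)$ (resp. $\mathrm{succ}_T(y)$) is the largest (resp. smallest) key of $T$ smaller (resp. larger) than $y$. Given a BST $T_1$, a connected subtree $\tau$ of $T_1$ containing the root, and a BST $\tau'$ whose key set equals that of $\tau$, or that of $\tau$ plus one key not in $T_1$, or that of $\tau$ minus one key, the reconfiguration $\tau\to\tau'$ is valid and transforms $T_1$ into $T_2$ if $T_2$ is a BST on $(\mathrm{keys}(T_1)\setminus\mathrm{keys}(\tau))\cup\mathrm{keys}(\tau')$ in which $\tau'$ is the connected subtree containing the root on the keys of $\tau'$, and every node of $T_1$ not in $\tau$ has the same left and right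 children in $T_2$ as in $T_1$. An execution of $S$ is $E=\langle T_0,\tau_1\to\tau_1',\dots,\tau_m\to\tau_m'\rangle$ where $T_0$ is a BST on a subset of $[n]$, each $\tau_t\to\tau'_t$ is a valid reconfiguration transforming $T_{t-1}$ into $T_t$, and for all $t$: if $\mathrm{op}_t=\mathtt{access}$ then $s_t\in\tau_t$ and $\tau_t'$ has the same key set as $\tau_t$; if $\mathtt{insert}$ then $\mathrm{keys}(\tau'_t)=\mathrm{keys}(\tau_t)\cup\{s_t\}$ with $s_t\notin\tau_t$; if $\mathtt{delete}$ then $\mathrm{keys}(\tau_t)=\mathrm{keys}(\tau'_t)\cup\{s_t\}$ with $s_t\notin\tau'_t$. Geometric view. Points $p=(p_x,p_t)\in[n]\times[m]$. $I(S)=\{(s_t,t):\mathrm{op}_t=\mathtt{insert}\}$, $D(S)=\{(s_t,t):\mathrm{op}_t=\mathtt{delete}\}$, $A(S)=\{(s_t,t):\mathrm{op}_t=\mathtt{access}\}$, $U(S)=I(S)\cup D(S)$, $P(S)=A(S)\cup U(S)$. For a point $p$, let $p'$ (resp. $p''$) be the point of $U(S)$ in column $p_x$ with largest time $<p_t$ (resp. smallest time $>p_t$), if it exists. $p$ is valid iff (1) $p\notin U(S)$, $p'\in I(S)$ or nonexistent, $p''\in D(S)$ or nonexistent; or (2) $p\in I(S)$, $p'\in D(S)$ or nonexistent, $p''\in D(S)$ or nonexistent; or (3) $p\in D(S)$, $p'\in I(S)$ or nonexistent, $p''\in I(S)$ or nonexistent. $\mathrm{pred}(p)$ is the point $(x',p_t)$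 where $x'$ is the largest $x'<p_x$ such that $(x',p_t)$ is valid (if any); $\mathrm{succ}(p)$ is symmetric with the smallest $x'>p_x$. -}

module Defs where

open import Data.Nat using (ℕ; zero; suc; _≤_; _<_; pred)
open import Data.Product using (Σ; ∃; ∃-syntax; _×_; _,_)
open import Data.Sum using (_⊎_)
open import Data.Unit using (⊤)
open import Data.List using (List; []; _∷_; length)
open import Data.Maybe using (Maybe; just; nothing)
open import Relation.Nullary using (¬_)
open import Relation.Binary.PropositionalEquality using (_≡_; _≢_)

_⇔_ : Set → Set → Set
A ⇔ B = (A → B) × (B → A)
infix 2 _⇔_

-- Update sequences.  Keys are naturals, [n] = {1,…,n}; times are 1,…,m
-- where m = length S.  (at S t) is the t-th entry (1-indexed).

data Op : Set where
  access insert delete : Op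

UpdSeq : Set
UpdSeq = List (ℕ × Op)

at : {A : Set} → List A → ℕ → Maybe A
at xs zero = nothing
at [] (suc t) = nothing
at (x ∷ xs) (suc zero) = just x
at (x ∷ xs) (suc (suc t)) = at xs (suc t)

InRange : ℕ → ℕ → Set
InRange n x = 1 ≤ x × x ≤ n

UpdAt : UpdSeq → ℕ → ℕ → Op → Set
UpdAt S x t o = (o ≢ access) × (at S t ≡ just (x , o))

KeysInRange : ℕ → UpdSeq → Set
KeysInRange n S = ∀ t x o → at S t ≡ just (x , o) → InRange n x

Alternating : UpdSeq → Set
Alternating S = ∀ x t₁ t₂ o₁ o₂ → t₁ < t₂ → UpdAt S x t₁ o₁ → UpdAt S x t₂ o₂ →
  (∀ u o → t₁ < u → u < t₂ → ¬ UpdAt S x u o) → o₁ ≢ o₂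

AllOccur : ℕ → UpdSeq → Set
AllOccur n S = ∀ x → InRange n x → ∃[ t ] ∃[ o ] (at S t ≡ just (x , o))

IsUpdateSeq : ℕ → UpdSeq → Set
IsUpdateSeq n S = KeysInRange n S × Alternating S × AllOccur n S

Point : Set
Point = ℕ × ℕ

I-pt D-pt A-pt U-pt P-pt : UpdSeq → Point → Set
I-pt S (x , t) = at S t ≡ just (x , insert)
D-pt S (x , t) = at S t ≡ just (x , delete)
A-pt S (x , t) = at S t ≡ just (x , access)
U-pt S p = I-pt S p ⊎ D-pt S p
P-pt S p = A-pt S p ⊎ U-pt S p

PrevUpd : UpdSeq → ℕ → ℕ → ℕ → Op → Set
PrevUpd S x t t' o = t' < t × UpdAt S x t' o × (∀ u o' → t' < u → u < t → ¬ UpdAt S x u o')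

NextUpd : UpdSeq → ℕ → ℕ → ℕ → Op → Set
NextUpd S x t t' o = t < t' × UpdAt S x t' o × (∀ u o' → t < u → u < t' → ¬ UpdAt S x u o')

-- "p' ∈ X or p' does not exist", where p' is unique when it exists
PrevIs : UpdSeq → Point → Op → Set
PrevIs S (x , t) o = ∀ t' o' → PrevUpd S x t t' o' → o' ≡ o

NextIs : UpdSeq → Point → Op → Set
NextIs S (x , t) o = ∀ t' o' → NextUpd S x t t' o' → o' ≡ o

Valid : ℕ → UpdSeq → Point → Set
Valid n S (x , t) =
  InRange n x × InRange (length S) t ×
  ( (¬ U-pt S (x , t) × PrevIs S (x , t) insert × NextIs S (x , t) delete)
  ⊎ (I-pt S (x , t) × PrevIs S (x , t) delete × NextIs S (x , t) delete)
  ⊎ (D-pt S (x , t) × PrevIs S (x , t) insert × NextIs S (x , t) insert))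

-- pred(p) = (x' , p_t)  (stated as a relation on x')
IsPredPt : ℕ → UpdSeq → Point → ℕ → Set
IsPredPt n S (x , t) x' =
  x' < x × Valid n S (x' , t) × (∀ y → x' < y → y < x → ¬ Valid n S (y , t))

IsSuccPt : ℕ → UpdSeq → Point → ℕ → Set
IsSuccPt n S (x , t) x' =
  x < x' × Valid n S (x' , t) × (∀ y → x < y → y < x' → ¬ Valid n S (y , t))

data Tree : Set where
  leaf : Tree
  node : Tree → ℕ → Tree → Tree

data _∈T_ : ℕ → Tree → Set where
  here  : ∀ {l k r} → k ∈T node l k r
  left  : ∀ {l k r y} → y ∈T l → y ∈T node l k r
  right : ∀ {l k r y} → y ∈T r → y ∈T node l k r

_∉T_ : ℕ → Tree → Set
y ∉T T = ¬ (y ∈T T)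

AllT : (ℕ → Set) → Tree → Set
AllT P T = ∀ y → y ∈T T → P y

IsBST : ℕ → Tree → Set
IsBST n leaf = ⊤
IsBST n (node l k r) =
  InRange n k × AllT (_< k) l × AllT (k <_) r × IsBST n l × IsBST n r

rootKey : Tree → Maybe ℕ
rootKey leaf = nothing
rootKey (node l k r) = just k

data Children : Tree → ℕ → Maybe ℕ → Maybe ℕ → Set where
  here  : ∀ {l k r} → Children (node l k r) k (rootKey l) (rootKey r)
  left  : ∀ {l k r y a b} → Children l y a b → Children (node l k r) y a b
  right : ∀ {l k r y a b} → Children r y a b → Children (node l k r) y a b

-- IsTop τ T : τ is a connected subtree of T containing the root
-- (τ is represented as a tree: T with some subtrees cut off)
data IsTop : Tree → Tree → Set where
  leaf : ∀ {T} → IsTop leaf T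
  node : ∀ {l k r L R} → IsTop l L → IsTop r R → IsTop (node l k r) (node L k R)

pred-T : Tree → ℕ → ℕ → Set
pred-T T y x' = x' ∈T T × x' < y × (∀ z → z ∈T T → z < y → z ≤ x')

succ-T : Tree → ℕ → ℕ → Set
succ-T T y x' = x' ∈T T × y < x' × (∀ z → z ∈T T → y < z → x' ≤ z)

SameKeys : Tree → Tree → Set
SameKeys A B = ∀ k → k ∈T A ⇔ k ∈T B

ValidReconf : ℕ → Tree → Tree → Tree → Tree → Set
ValidReconf n T₁ τ τ' T₂ =
  IsTop τ T₁ × IsBST n τ' ×
  ( SameKeys τ' τ
  ⊎ (∃[ y ] (y ∉T T₁ × (∀ k → k ∈T τ' ⇔ (k ∈T τ ⊎ k ≡ y))))
  ⊎ (∃[ y ] (y ∈T τ × (∀ k → k ∈T τ' ⇔ (k ∈T τ × k ≢ y))))) ×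
  IsBST n T₂ ×
  (∀ k → k ∈T T₂ ⇔ ((k ∈T T₁ × k ∉T τ) ⊎ k ∈T τ')) ×
  IsTop τ' T₂ ×
  (∀ k a b → k ∈T T₁ → k ∉T τ → Children T₁ k a b → Children T₂ k a b)

OpOK : Op → ℕ → Tree → Tree → Set
OpOK access s τ τ' = s ∈T τ × SameKeys τ τ'
OpOK insert s τ τ' = s ∉T τ × (∀ k → k ∈T τ' ⇔ (k ∈T τ ⊎ k ≡ s))
OpOK delete s τ τ' = s ∉T τ' × (∀ k → k ∈T τ ⇔ (k ∈T τ' ⊎ k ≡ s))

-- E = ⟨T₀, τ₁ → τ₁', …, τₘ → τₘ'⟩ ; T t is the tree after the t-th
-- reconfiguration (T 0 = T₀); values of T, τ, τ' outside the range are irrelevant.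
IsExecution : ℕ → UpdSeq → (ℕ → Tree) → (ℕ → Tree) → (ℕ → Tree) → Set
IsExecution n S T τ τ' =
  IsBST n (T 0) ×
  (∀ t s o → at S t ≡ just (s , o) →
     ValidReconf n (T (pred t)) (τ t) (τ' t) (T t) × OpOK o s (τ t) (τ' t))

module Submission where

-- Fix an update point p = (x , t) and look at a key
-- y ≠ x at the same time t.  No update of y happens at time t, and along
-- column y the execution behaves like a two-state automaton: an insertion
-- of y leaves y in the tree, a deletion removes it, an access requires it,
-- and every other reconfiguration leaves y's membership unchanged.  Hence
-- y ∈ T t is decided by the latest update of y before t (present iff it is
-- an insertion), or else by the earliest update after t (present iff it is
-- a deletion), or else, when y is never updated, y is present because it is
-- accessed at some time.  These are exactly the three clauses of case (1)
-- of validity, so (y , t) is valid iff y ∈ T t, for every y ≠ x.  Two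
-- predicates on keys that agree away from x have the same nearest element
-- below and above x, which gives pred(p) = pred_T(x) and succ(p) = succ_T(x).

open import Defs
open import Data.Nat using (ℕ; zero; suc; _≤_; _<_; _+_; z≤n; s≤s; _≟_; _≤?_)
open import Data.Nat.Properties
  using (≤-refl; ≤-trans; ≤-pred; ≤-total; <⇒≤; <⇒≢; <-trans; <-irrefl; <-≤-trans;
         ≰⇒>; <⇒≱; <-cmp; n≤1+n; n<1+n; m<n⇒m<1+n; m≤m+n; +-suc; m≤n⇒m<n∨m≡n)
open import Relation.Binary.Definitions using (DecidableEquality; tri<; tri≈; tri>)
open import Data.Product using (Σ; _×_; _,_; proj₁; proj₂)
open import Data.Product.Properties using () renaming (≡-dec to ×-≡-dec)
open import Data.Sum using (_⊎_; inj₁; inj₂)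
open import Data.Empty using (⊥-elim)
open import Data.List using (List; []; _∷_; length)
open import Data.Maybe using (just)
open import Data.Maybe.Properties using (just-injective) renaming (≡-dec to Maybe-≡-dec)
open import Relation.Nullary using (¬_; Dec; yes; no)
open import Relation.Nullary.Decidable using (map′; ¬?; _×-dec_; _⊎-dec_)
open import Relation.Binary.PropositionalEquality using (_≡_; _≢_; refl; sym; trans; cong; subst; ≢-sym)
open import Function using (id; _∘_)

⇔-refl : ∀ {A : Set} → A ⇔ A
⇔-refl = id , id

⇔-sym : ∀ {A B : Set} → A ⇔ B → B ⇔ A
⇔-sym (f , g) = g , f

_⟨⇔⟩_ : ∀ {A B C : Set} → A ⇔ B → B ⇔ C → A ⇔ C
(f , g) ⟨⇔⟩ (h , k) = h ∘ f , g ∘ k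
infixr 5 _⟨⇔⟩_

NearestBelow NearestAbove MaxBelow MinAbove : (ℕ → Set) → ℕ → ℕ → Set
NearestBelow V x x' = x' < x × V x' × (∀ y → x' < y → y < x → ¬ V y)
NearestAbove V x x' = x < x' × V x' × (∀ y → x < y → y < x' → ¬ V y)
MaxBelow M x x' = M x' × x' < x × (∀ z → M z → z < x → z ≤ x')
MinAbove M x x' = M x' × x < x' × (∀ z → M z → x < z → x' ≤ z)

-- If V and M agree on all keys below x, the two notions of predecessor of x
-- coincide (comparison of keys is decidable, so "no V-key in between" and
-- "dominates every M-key" are interchangeable).
nearest-below : ∀ {V M : ℕ → Set} {x} → (∀ y → y < x → V y ⇔ M y) →
  ∀ x' → NearestBelow V x x' ⇔ MaxBelow M x x'
nearest-below {V} {M} {x} agree x' = to , from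
  where
  to : NearestBelow V x x' → MaxBelow M x x'
  to (x'<x , vx' , gap) = proj₁ (agree x' x'<x) vx' , x'<x , dominates
    where
    dominates : ∀ z → M z → z < x → z ≤ x'
    dominates z mz z<x with z ≤? x'
    ... | yes z≤x' = z≤x'
    ... | no z≰x' = ⊥-elim (gap z (≰⇒> z≰x') z<x (proj₂ (agree z z<x) mz))
  from : MaxBelow M x x' → NearestBelow V x x'
  from (mx' , x'<x , dominates) = x'<x , proj₂ (agree x' x'<x) mx' ,
    λ y x'<y y<x vy → <⇒≱ x'<y (dominates y (proj₁ (agree y y<x) vy) y<x)

nearest-above : ∀ {V M : ℕ → Set} {x} → (∀ y → x < y → V y ⇔ M y) →
  ∀ x' → NearestAbove V x x' ⇔ MinAbove M x x'
nearest-above {V} {M} {x} agree x' = to , from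
  where
  to : NearestAbove V x x' → MinAbove M x x'
  to (x<x' , vx' , gap) = proj₁ (agree x' x<x') vx' , x<x' , dominated
    where
    dominated : ∀ z → M z → x < z → x' ≤ z
    dominated z mz x<z with x' ≤? z
    ... | yes x'≤z = x'≤z
    ... | no x'≰z = ⊥-elim (gap z x<z (≰⇒> x'≰z) (proj₂ (agree z x<z) mz))
  from : MinAbove M x x' → NearestAbove V x x'
  from (mx' , x<x' , dominated) = x<x' , proj₂ (agree x' x<x') mx' ,
    λ y x<y y<x' vy → <⇒≱ y<x' (dominated y (proj₁ (agree y x<y) vy) x<y)

LatestBefore EarliestAfter : (ℕ → Set) → ℕ → ℕ → Set
LatestBefore Q t t' = t' < t × Q t' × (∀ u → t' < u → u < t → ¬ Q u)
EarliestAfter Q t t' = t < t' × Q t' × (∀ u → t < u → u < t' → ¬ Q u)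

extend-below : ∀ {R : ℕ → Set} {t} → (∀ u → u < t → R u) → R t → ∀ u → u < suc t → R u
extend-below below at-t u u<1+t with m≤n⇒m<n∨m≡n (≤-pred u<1+t)
... | inj₁ u<t = below u u<t
... | inj₂ refl = at-t

extend-above : ∀ {R : ℕ → Set} {t} → R (suc t) → (∀ u → suc t < u → R u) → ∀ u → t < u → R u
extend-above at-1+t above u t<u with m≤n⇒m<n∨m≡n t<u
... | inj₁ 1+t<u = above u 1+t<u
... | inj₂ refl = at-1+t

module NearestWitness {Q : ℕ → Set} (Q? : ∀ u → Dec (Q u)) where

  latest-before : ∀ t → Σ ℕ (LatestBefore Q t) ⊎ (∀ u → u < t → ¬ Q u)
  latest-before zero = inj₂ λ u ()
  latest-before (suc t) with Q? t | latest-before t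
  ... | yes qt | _ = inj₁ (t , n<1+n t , qt ,
          λ u t<u u<1+t → ⊥-elim (<-irrefl refl (<-≤-trans t<u (≤-pred u<1+t))))
  ... | no ¬qt | inj₁ (t' , t'<t , qt' , gap) =
          inj₁ (t' , m<n⇒m<1+n t'<t , qt' , λ u t'<u u<1+t →
            extend-below {λ v → t' < v → ¬ Q v} (λ v v<t t'<v → gap v t'<v v<t) (λ _ → ¬qt)
                         u u<1+t t'<u)
  ... | no ¬qt | inj₂ none = inj₂ (extend-below none ¬qt)

  earliest-within : ∀ d t → Σ ℕ (EarliestAfter Q t) ⊎ (∀ u → t < u → u ≤ d + t → ¬ Q u)
  earliest-within zero t = inj₂ λ u t<u u≤t → ⊥-elim (<-irrefl refl (<-≤-trans t<u u≤t))
  earliest-within (suc d) t with Q? (suc t) | earliest-within d (suc t)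
  ... | yes q | _ = inj₁ (suc t , n<1+n t , q ,
          λ u t<u u<1+t → ⊥-elim (<-irrefl refl (<-≤-trans t<u (≤-pred u<1+t))))
  ... | no ¬q | inj₁ (t' , 1+t<t' , qt' , gap) =
          inj₁ (t' , <-trans (n<1+n t) 1+t<t' , qt' , extend-above (λ _ → ¬q) gap)
  ... | no ¬q | inj₂ none =
          inj₂ (extend-above (λ _ → ¬q) λ u 1+t<u u≤ → none u 1+t<u (subst (u ≤_) (sym (+-suc d t)) u≤))

  earliest-after : ∀ b → (∀ u → Q u → u ≤ b) → ∀ t → Σ ℕ (EarliestAfter Q t) ⊎ (∀ u → t < u → ¬ Q u)
  earliest-after b bounded t with earliest-within b t
  ... | inj₁ found = inj₁ found
  ... | inj₂ none = inj₂ λ u t<u qu → none u t<u (≤-trans (bounded u qu) (m≤m+n b t)) qu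

_∈?_ : (k : ℕ) (T : Tree) → Dec (k ∈T T)
k ∈? leaf = no λ ()
k ∈? node l k' r with k ≟ k' | k ∈? l | k ∈? r
... | yes refl | _ | _ = yes here
... | no _ | yes k∈l | _ = yes (left k∈l)
... | no _ | no _ | yes k∈r = yes (right k∈r)
... | no k≢k' | no k∉l | no k∉r =
  no λ { here → k≢k' refl ; (left k∈l) → k∉l k∈l ; (right k∈r) → k∉r k∈r }

top-⊆ : ∀ {τ T k} → IsTop τ T → k ∈T τ → k ∈T T
top-⊆ (node tl tr) here = here
top-⊆ (node tl tr) (left k∈l) = left (top-⊆ tl k∈l)
top-⊆ (node tl tr) (right k∈r) = right (top-⊆ tr k∈r)

bst-inRange : ∀ {n k} T → IsBST n T → k ∈T T → InRange n k
bst-inRange (node l k r) (k∈[n] , _) here = k∈[n]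
bst-inRange (node l k r) (_ , _ , _ , bst-l , _) (left k∈l) = bst-inRange l bst-l k∈l
bst-inRange (node l k r) (_ , _ , _ , _ , bst-r) (right k∈r) = bst-inRange r bst-r k∈r

-- A single valid reconfiguration T₁ → T₂.  Keys outside τ are untouched,
-- so a key's membership can only change if it changes between τ and τ'.

reconf-transfer : ∀ {n T₁ τ τ' T₂ y} → ValidReconf n T₁ τ τ' T₂ →
  (y ∈T τ ⇔ y ∈T τ') → (y ∈T T₁ ⇔ y ∈T T₂)
reconf-transfer {T₁ = T₁} {τ} {T₂ = T₂} {y} (top , _ , _ , _ , keys , _) (into , back) = to , from
  where
  to : y ∈T T₁ → y ∈T T₂
  to y∈T₁ with y ∈? τ
  ... | yes y∈τ = proj₂ (keys y) (inj₂ (into y∈τ))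
  ... | no y∉τ = proj₂ (keys y) (inj₁ (y∈T₁ , y∉τ))
  from : y ∈T T₂ → y ∈T T₁
  from y∈T₂ with proj₁ (keys y) y∈T₂
  ... | inj₁ (y∈T₁ , _) = y∈T₁
  ... | inj₂ y∈τ' = top-⊆ top (back y∈τ')

other-key : ∀ {A : Set} {s y : ℕ} → s ≢ y → A ⊎ y ≡ s → A
other-key _ (inj₁ a) = a
other-key s≢y (inj₂ refl) = ⊥-elim (s≢y refl)

op-preserves : ∀ {o s τ τ' y} → OpOK o s τ τ' → (o ≢ access → s ≢ y) → y ∈T τ ⇔ y ∈T τ'
op-preserves {access} {y = y} (_ , same) _ = same y
op-preserves {insert} {y = y} (_ , keys) not-s =
  (λ y∈τ → proj₂ (keys y) (inj₁ y∈τ)) , other-key (not-s (λ ())) ∘ proj₁ (keys y)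
op-preserves {delete} {y = y} (_ , keys) not-s =
  other-key (not-s (λ ())) ∘ proj₁ (keys y) , (λ y∈τ' → proj₂ (keys y) (inj₁ y∈τ'))

-- Inserting s: s was absent from T₁ (the only key τ' may add is a key of
-- no T₁-node) and is present in T₂.
reconf-insert : ∀ {n T₁ τ τ' T₂ s} → ValidReconf n T₁ τ τ' T₂ → OpOK insert s τ τ' →
  s ∉T T₁ × s ∈T T₂
reconf-insert {T₁ = T₁} {τ} {τ'} {s = s} (_ , _ , shape , _ , keys , _) (s∉τ , added) =
  absent shape , proj₂ (keys s) (inj₂ s∈τ')
  where
  s∈τ' : s ∈T τ'
  s∈τ' = proj₂ (added s) (inj₂ refl)
  absent : SameKeys τ' τ
         ⊎ Σ ℕ (λ z → z ∉T T₁ × (∀ k → k ∈T τ' ⇔ (k ∈T τ ⊎ k ≡ z)))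
         ⊎ Σ ℕ (λ z → z ∈T τ × (∀ k → k ∈T τ' ⇔ (k ∈T τ × k ≢ z))) →
         s ∉T T₁
  absent (inj₁ same) _ = s∉τ (proj₁ (same s) s∈τ')
  absent (inj₂ (inj₁ (z , z∉T₁ , grown))) s∈T₁ with proj₁ (grown s) s∈τ'
  ... | inj₁ s∈τ = s∉τ s∈τ
  ... | inj₂ refl = z∉T₁ s∈T₁
  absent (inj₂ (inj₂ (z , _ , shrunk))) _ = s∉τ (proj₁ (proj₁ (shrunk s) s∈τ'))

-- Deleting s: s was in τ, hence in T₁, and is in neither T₂ \ τ' nor τ'.
reconf-delete : ∀ {n T₁ τ τ' T₂ s} → ValidReconf n T₁ τ τ' T₂ → OpOK delete s τ τ' →
  s ∈T T₁ × s ∉T T₂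
reconf-delete {τ = τ} {T₂ = T₂} {s} (top , _ , _ , _ , keys , _) (s∉τ' , removed) =
  top-⊆ top s∈τ , absent
  where
  s∈τ : s ∈T τ
  s∈τ = proj₂ (removed s) (inj₂ refl)
  absent : s ∉T T₂
  absent s∈T₂ with proj₁ (keys s) s∈T₂
  ... | inj₁ (_ , s∉τ) = s∉τ s∈τ
  ... | inj₂ s∈τ' = s∉τ' s∈τ'

reconf-access : ∀ {n T₁ τ τ' T₂ s} → ValidReconf n T₁ τ τ' T₂ → OpOK access s τ τ' → s ∈T T₁
reconf-access (top , _) (s∈τ , _) = top-⊆ top s∈τ

at-inRange : ∀ {A : Set} (xs : List A) t {v} → at xs t ≡ just v → InRange (length xs) t
at-inRange xs zero ()
at-inRange [] (suc t) ()
at-inRange (x ∷ xs) (suc zero) _ = s≤s z≤n , s≤s z≤n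
at-inRange (x ∷ xs) (suc (suc t)) e = s≤s z≤n , s≤s (proj₂ (at-inRange xs (suc t) e))

at-defined : ∀ {A : Set} (xs : List A) t → InRange (length xs) t → Σ A λ v → at xs t ≡ just v
at-defined [] (suc t) (_ , ())
at-defined (x ∷ xs) (suc zero) _ = x , refl
at-defined (x ∷ xs) (suc (suc t)) (_ , s≤s t<len) = at-defined xs (suc t) (s≤s z≤n , t<len)

_≟Op_ : DecidableEquality Op
access ≟Op access = yes refl
insert ≟Op insert = yes refl
delete ≟Op delete = yes refl
access ≟Op insert = no λ ()
access ≟Op delete = no λ ()
insert ≟Op access = no λ ()
insert ≟Op delete = no λ ()
delete ≟Op access = no λ ()
delete ≟Op insert = no λ ()

updAt? : ∀ S y u o → Dec (UpdAt S y u o)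
updAt? S y u o = ¬? (o ≟Op access) ×-dec Maybe-≡-dec (×-≡-dec _≟_ _≟Op_) (at S u) (just (y , o))

updated? : ∀ S y u → Dec (Σ Op (UpdAt S y u))
updated? S y u = map′ witness cases (updAt? S y u insert ⊎-dec updAt? S y u delete)
  where
  witness : UpdAt S y u insert ⊎ UpdAt S y u delete → Σ Op (UpdAt S y u)
  witness (inj₁ up) = insert , up
  witness (inj₂ up) = delete , up
  cases : Σ Op (UpdAt S y u) → UpdAt S y u insert ⊎ UpdAt S y u delete
  cases (access , a≢a , _) = ⊥-elim (a≢a refl)
  cases (insert , up) = inj₁ up
  cases (delete , up) = inj₂ up

module Column {n S} {T τ τ' : ℕ → Tree} (ex : IsExecution n S T τ τ') (y : ℕ) where

  Updated NotUpdated : ℕ → Set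
  Updated u = Σ Op (UpdAt S y u)
  NotUpdated u = ∀ o → ¬ UpdAt S y u o

  open NearestWitness (updated? S y) using (latest-before; earliest-after)

  reconf-at : ∀ {k s o} → at S (suc k) ≡ just (s , o) →
    ValidReconf n (T k) (τ (suc k)) (τ' (suc k)) (T (suc k)) × OpOK o s (τ (suc k)) (τ' (suc k))
  reconf-at e = proj₂ ex _ _ _ e

  tree-bst : ∀ t → t ≤ length S → IsBST n (T t)
  tree-bst zero _ = proj₁ ex
  tree-bst (suc k) bound with at-defined S (suc k) (s≤s z≤n , bound)
  ... | _ , e with reconf-at e
  ...   | (_ , _ , _ , bst , _) , _ = bst

  unchanged : ∀ k → suc k ≤ length S → NotUpdated (suc k) → y ∈T T k ⇔ y ∈T T (suc k)
  unchanged k bound not-upd with at-defined S (suc k) (s≤s z≤n , bound)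
  ... | (s , o) , e with reconf-at e
  ...   | reconf , ok = reconf-transfer reconf (op-preserves ok not-y)
    where
    not-y : o ≢ access → s ≢ y
    not-y o≢access refl = not-upd o (o≢access , e)

  after-update : ∀ {t o} → UpdAt S y t o → y ∈T T t ⇔ o ≡ insert
  after-update {zero} (_ , ())
  after-update {suc k} {access} (a≢a , _) = ⊥-elim (a≢a refl)
  after-update {suc k} {insert} (_ , e) with reconf-at e
  ... | reconf , ok = (λ _ → refl) , (λ _ → proj₂ (reconf-insert reconf ok))
  after-update {suc k} {delete} (_ , e) with reconf-at e
  ... | reconf , ok = (λ y∈ → ⊥-elim (proj₂ (reconf-delete reconf ok) y∈)) , λ ()

  before-update : ∀ {k o} → UpdAt S y (suc k) o → y ∈T T k ⇔ o ≡ delete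
  before-update {o = access} (a≢a , _) = ⊥-elim (a≢a refl)
  before-update {o = insert} (_ , e) with reconf-at e
  ... | reconf , ok = (λ y∈ → ⊥-elim (proj₁ (reconf-insert reconf ok) y∈)) , λ ()
  before-update {o = delete} (_ , e) with reconf-at e
  ... | reconf , ok = (λ _ → refl) , (λ _ → proj₁ (reconf-delete reconf ok))

  before-access : ∀ {k} → at S (suc k) ≡ just (y , access) → y ∈T T k
  before-access e with reconf-at e
  ... | reconf , ok = reconf-access reconf ok

  persist : ∀ a b → a ≤ b → b ≤ length S → (∀ u → a < u → u ≤ b → NotUpdated u) →
    y ∈T T a ⇔ y ∈T T b
  persist a zero z≤n _ _ = ⇔-refl
  persist a (suc b) a≤1+b bound quiet with m≤n⇒m<n∨m≡n a≤1+b
  ... | inj₂ refl = ⇔-refl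
  ... | inj₁ (s≤s a≤b) =
    persist a b a≤b (≤-trans (n≤1+n b) bound) (λ u a<u u≤b → quiet u a<u (≤-trans u≤b (n≤1+n b)))
    ⟨⇔⟩ unchanged b bound (quiet (suc b) (s≤s a≤b) ≤-refl)

  present-after-latest : ∀ {t t' o} → PrevUpd S y t t' o → NotUpdated t → t ≤ length S →
    y ∈T T t ⇔ o ≡ insert
  present-after-latest {t} {t'} (t'<t , up , gap) not-upd bound =
    ⇔-sym (persist t' t (<⇒≤ t'<t) bound quiet) ⟨⇔⟩ after-update up
    where
    quiet : ∀ u → t' < u → u ≤ t → NotUpdated u
    quiet u t'<u u≤t with m≤n⇒m<n∨m≡n u≤t
    ... | inj₁ u<t = λ o → gap u o t'<u u<t
    ... | inj₂ refl = not-upd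

  present-before-earliest : ∀ {t t' o} → NextUpd S y t t' o → y ∈T T t ⇔ o ≡ delete
  present-before-earliest {t' = zero} (() , _)
  present-before-earliest {t} {suc j} (t<1+j , up@(_ , e) , gap) =
    persist t j (≤-pred t<1+j) j≤len (λ u t<u u≤j o → gap u o t<u (s≤s u≤j)) ⟨⇔⟩ before-update up
    where
    j≤len : j ≤ length S
    j≤len = ≤-trans (n≤1+n j) (proj₂ (at-inRange S (suc j) e))

  present-if-never-updated : AllOccur n S → InRange n y → (∀ u → NotUpdated u) →
    ∀ t → t ≤ length S → y ∈T T t
  present-if-never-updated occ y∈[n] never t bound with occ y y∈[n]
  ... | zero , _ , ()
  ... | suc k , insert , e = ⊥-elim (never (suc k) insert ((λ ()) , e))
  ... | suc k , delete , e = ⊥-elim (never (suc k) delete ((λ ()) , e))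
  ... | suc k , access , e with ≤-total k t
  ...   | inj₁ k≤t = proj₁ (persist k t k≤t bound (λ u _ _ → never u)) (before-access e)
  ...   | inj₂ t≤k = proj₂ (persist t k t≤k k≤len (λ u _ _ → never u)) (before-access e)
    where
    k≤len : k ≤ length S
    k≤len = ≤-trans (n≤1+n k) (proj₂ (at-inRange S (suc k) e))

  latest⇒prev : ∀ {t t'} → LatestBefore Updated t t' → Σ Op (PrevUpd S y t t')
  latest⇒prev (t'<t , (o , up) , gap) = o , t'<t , up , λ u o' t'<u u<t up' → gap u t'<u u<t (o' , up')

  earliest⇒next : ∀ {t t'} → EarliestAfter Updated t t' → Σ Op (NextUpd S y t t')
  earliest⇒next (t<t' , (o , up) , gap) = o , t<t' , up , λ u o' t<u u<t' up' → gap u t<u u<t' (o' , up')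

  valid⇔present : AllOccur n S → ∀ t → InRange (length S) t → NotUpdated t →
    Valid n S (y , t) ⇔ y ∈T T t
  valid⇔present occ t t∈[m] not-upd = to , from
    where
    bound : t ≤ length S
    bound = proj₂ t∈[m]

    not-update-point : ¬ U-pt S (y , t)
    not-update-point (inj₁ ins) = not-upd insert ((λ ()) , ins)
    not-update-point (inj₂ del) = not-upd delete ((λ ()) , del)

    never-updated : (∀ u → u < t → ¬ Updated u) → (∀ u → t < u → ¬ Updated u) →
      ∀ u → NotUpdated u
    never-updated before after u o up with <-cmp u t
    ... | tri< u<t _ _ = before u u<t (o , up)
    ... | tri≈ _ refl _ = not-upd o up
    ... | tri> _ _ t<u = after u t<u (o , up)

    present-if-valid : InRange n y → PrevIs S (y , t) insert → NextIs S (y , t) delete → y ∈T T t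
    present-if-valid y∈[n] prev-ins next-del with latest-before t
    ... | inj₁ (t' , latest) with latest⇒prev latest
    ...   | o , prev = proj₂ (present-after-latest prev not-upd bound) (prev-ins t' o prev)
    present-if-valid y∈[n] prev-ins next-del | inj₂ none-before
      with earliest-after (length S) (λ u (_ , _ , e) → proj₂ (at-inRange S u e)) t
    ... | inj₁ (t' , earliest) with earliest⇒next earliest
    ...   | o , next = proj₂ (present-before-earliest next) (next-del t' o next)
    present-if-valid y∈[n] prev-ins next-del | inj₂ none-before | inj₂ none-after =
      present-if-never-updated occ y∈[n] (never-updated none-before none-after) t bound

    to : Valid n S (y , t) → y ∈T T t
    to (y∈[n] , _ , inj₁ (_ , prev-ins , next-del)) = present-if-valid y∈[n] prev-ins next-del
    to (_ , _ , inj₂ (inj₁ (ins , _))) = ⊥-elim (not-update-point (inj₁ ins))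
    to (_ , _ , inj₂ (inj₂ (del , _))) = ⊥-elim (not-update-point (inj₂ del))

    from : y ∈T T t → Valid n S (y , t)
    from y∈T = bst-inRange (T t) (tree-bst t bound) y∈T , t∈[m] ,
      inj₁ ( not-update-point
           , (λ _ _ prev → proj₁ (present-after-latest prev not-upd bound) y∈T)
           , (λ _ _ next → proj₁ (present-before-earliest next) y∈T))

update-point : ∀ {S x t} → U-pt S (x , t) →
  InRange (length S) t × (∀ y → y ≢ x → ∀ o → ¬ UpdAt S y t o)
update-point {S} {x} {t} (inj₁ ins) = at-inRange S t ins , λ y y≢x o (_ , e) →
  y≢x (cong proj₁ (just-injective (trans (sym e) ins)))
update-point {S} {x} {t} (inj₂ del) = at-inRange S t del , λ y y≢x o (_ , e) →
  y≢x (cong proj₁ (just-injective (trans (sym e) del)))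

-- Lemma 8: at an update point p, pred(p) and succ(p) are the predecessor
-- and successor of p_x in the tree T_{p_t}.
lemma8 : (n : ℕ) (S : UpdSeq) → IsUpdateSeq n S →
    (P : Point → Set) → (∀ p → P-pt S p → P p) → (∀ p → P p → Valid n S p) →
    (T τ τ' : ℕ → Tree) → IsExecution n S T τ τ' →
    ∀ p → U-pt S p →
    (∀ x' → IsPredPt n S p x' ⇔ pred-T (T (proj₂ p)) (proj₁ p) x') ×
    (∀ x' → IsSuccPt n S p x' ⇔ succ-T (T (proj₂ p)) (proj₁ p) x')
lemma8 n S (_ , _ , occ) _ _ _ T τ τ' ex (x , t) upd =
  nearest-below (λ y y<x → valid⇔member y (<⇒≢ y<x)) ,
  nearest-above (λ y x<y → valid⇔member y (≢-sym (<⇒≢ x<y)))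
  where
  valid⇔member : ∀ y → y ≢ x → Valid n S (y , t) ⇔ y ∈T T t
  valid⇔member y y≢x with update-point upd
  ... | t∈[m] , others = Column.valid⇔present ex y occ t t∈[m] (others y y≢x)
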